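{- Let $k$ be a field, let $C$ be a locally 2-connected $k$-local generalised simplicial complex, and let $G$ be a graph whose cycle matroid equals the $k$-dual matroid of $C$ (edges of $G$ identified with faces of $C$). Then $(C,G)$ is sparse: for every vertex $v$ of $G$ and every edge $e$ of $C$, the number of faces of $C$ that are incident with $e$ in $C$ and, regarded as edges of $G$, incident with $v$ in $G$, is either exactly two or exactly zero.
   Context: A 2-dimensional simplicial complex $C=(V,E,F)$ has vertices, edges and triangular faces, every edge incident with some face; a generalised simplicial complex is a simplicial complex together with additional parallel faces (copies of faces with the same incidences). The link graph $L(v)$ has as vertices the edges of $C$ at $v$ and as edges the faces containing $v$ (identified with these faces). $C$ is locally 2-connected if all link graphs are 2-connected. With edges directed and faces oriented, the incidence vector of an edge $e$ in $\{0,\pm1\}^F$ has $f$-entry $0$ if $e$ is not in $f$ and $\pm1$ according to whether the direction of $e$ agrees with the orientation of $f$. The $k$-dual matroid of $C$ is the matroid on $F$ whose circuit space (span in $k^F$ of its signed circuits) is the span of the incidence vectors of the edges. $C$ is $k$-local if for every vertex $v$ the dual of the cycle matroid of $L(v)$ equals the restriction of the $k$-dual matroid to the faces containing $v$. -}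

module Defs where

open import Level using (Level; 0ℓ; _⊔_) renaming (suc to lsuc)
open import Data.Nat using (ℕ; zero; suc)
open import Data.Fin using (Fin; zero; suc; inject₁; fromℕ; _≟_)
open import Data.Bool using (Bool; true; false; T; _∨_; _∧_; if_then_else_)
open import Data.Product using (Σ; ∃; _×_; _,_)
open import Data.Sum using (_⊎_)
open import Data.Unit using (⊤)
open import Data.Empty using (⊥)
open import Relation.Nullary using (¬_; does)
open import Relation.Unary using (Pred; _⊆_)
open import Relation.Binary.PropositionalEquality using (_≡_; _≢_)
open import Relation.Binary.Construct.Closure.ReflexiveTransitive using (Star)
open import Function.Definitions using (Injective)
open import Algebra.Bundles using (CommutativeRing)

record Field : Set₁ where
  field
    commRing : CommutativeRing 0ℓ 0ℓ
  open CommutativeRing commRing public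
  field
    0≉1 : ¬ (0# ≈ 1#)
    inverse : ∀ x → ¬ (x ≈ 0#) → ∃ λ y → (x * y) ≈ 1#

nx : Fin 3 → Fin 3
nx zero = suc zero
nx (suc zero) = suc (suc zero)
nx (suc (suc zero)) = zero

SameEnds : ∀ {A : Set} → A → A → A → A → Set
SameEnds a b c d = (a ≡ c × b ≡ d) ⊎ (a ≡ d × b ≡ c)

count : ∀ n → (Fin n → Bool) → ℕ
count zero p = 0
count (suc n) p = (if p zero then 1 else 0) Data.Nat.+ count n (λ i → p (suc i))

anyFin3 : (Fin 3 → Bool) → Bool
anyFin3 p = p zero ∨ p (suc zero) ∨ p (suc (suc zero))

-- Generalised simplicial complexes (2-dimensional), with every edge
-- directed (tail → head) and every face oriented (cyclic order of fv f).
-- Vertices Fin nV, edges Fin nE, faces Fin nF.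
-- fe f i is the edge of f opposite to its vertex fv f i, i.e. the edge
-- joining fv f (i+1) and fv f (i+2).  Parallel faces (same incidences)
-- are allowed; parallel edges are not (the underlying complex is simplicial).

record GSC : Set where
  field
    nV nE nF : ℕ
    tail head : Fin nE → Fin nV
    loopless : ∀ e → tail e ≢ head e
    simple : ∀ e e′ → SameEnds (tail e) (head e) (tail e′) (head e′) → e ≡ e′
    fv : Fin nF → Fin 3 → Fin nV
    fv-inj : ∀ f → Injective _≡_ _≡_ (fv f)
    fe : Fin nF → Fin 3 → Fin nE
    fe-ends : ∀ f i → SameEnds (tail (fe f i)) (head (fe f i)) (fv f (nx i)) (fv f (nx (nx i)))
    covered : ∀ e → ∃ λ f → ∃ λ i → fe f i ≡ e

module _ (C : GSC) where
  open GSC C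

  inF : Fin nE → Fin nF → Bool
  inF e f = anyFin3 (λ i → does (fe f i ≟ e))

  atE : Fin nV → Fin nE → Bool
  atE v e = does (tail e ≟ v) ∨ does (head e ≟ v)

  atF : Fin nV → Fin nF → Bool
  atF v f = anyFin3 (λ i → does (fv f i ≟ v))

-- (Multi)graphs: a vertex type, an edge type, and the relation
-- "edge e joins u and w" (loops: Joins e u u).

record Graph : Set₁ where
  field
    V E : Set
    Joins : E → V → V → Set

module _ (G : Graph) where
  open Graph G

  -- a cycle: closed walk v0 e0 v1 … e_{n-1} v_n = v0, n ≥ 1,
  -- with distinct edges and distinct vertices v0 … v_{n-1}
  record Cycle : Set where
    field
      len : ℕ
      vs : Fin (suc (suc len)) → V
      es : Fin (suc len) → E
      closed : vs (fromℕ (suc len)) ≡ vs zero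
      step : ∀ i → Joins (es i) (vs (inject₁ i)) (vs (suc i))
      es-inj : Injective _≡_ _≡_ es
      vs-inj : Injective _≡_ _≡_ (λ i → vs (inject₁ i))

  cycleEdges : Cycle → Pred E 0ℓ
  cycleEdges c e = ∃ λ i → Cycle.es c i ≡ e

  CycleIndep : Pred E 0ℓ → Set
  CycleIndep X = ∀ (c : Cycle) → ¬ (cycleEdges c ⊆ X)

  AdjIn : Pred V 0ℓ → V → V → Set
  AdjIn P u w = P u × P w × ∃ λ e → Joins e u w

  -- 2-connected (Diestel): more than two vertices, and G − X connected
  -- for every set X of fewer than two vertices
  TwoConnected : Set
  TwoConnected =
    (∃ λ (a : V) → ∃ λ (b : V) → ∃ λ (c : V) → a ≢ b × a ≢ c × b ≢ c)
    × (∀ u w → Star (AdjIn (λ _ → ⊤)) u w)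
    × (∀ x u w → u ≢ x → w ≢ x → Star (AdjIn (λ y → y ≢ x)) u w)

module _ {E : Set} {a : Level} (I : Pred E 0ℓ → Set a) where

  IsBasis : Pred E 0ℓ → Set (lsuc 0ℓ ⊔ a)
  IsBasis B = I B × (∀ X → B ⊆ X → I X → X ⊆ B)

  DualIndep : Pred E 0ℓ → Set (lsuc 0ℓ ⊔ a)
  DualIndep X = ∃ λ (B : Pred E 0ℓ) → IsBasis B × (∀ e → B e → X e → ⊥)

SameMatroid : ∀ {E : Set} {a b : Level} → (Pred E 0ℓ → Set a) → (Pred E 0ℓ → Set b) → Set (lsuc 0ℓ ⊔ a ⊔ b)
SameMatroid I J = ∀ X → (I X → J X) × (J X → I X)

module _ (k : Field) (C : GSC) where
  open Field k using (Carrier; _≈_; _+_; _*_; -_; 0#; 1#)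
  open GSC C

  sumF : ∀ n → (Fin n → Carrier) → Carrier
  sumF zero g = 0#
  sumF (suc n) g = g zero + sumF n (λ i → g (suc i))

  incVec : Fin nE → Fin nF → Carrier
  incVec e f = sumF 3 (λ i →
    if does (fe f i ≟ e)
    then (if does (tail (fe f i) ≟ fv f (nx i)) then 1# else (- 1#))
    else 0#)

  InSpan : (Fin nF → Carrier) → Set
  InSpan w = ∃ λ (c : Fin nE → Carrier) → ∀ f → w f ≈ sumF nE (λ e → c e * incVec e f)

  support : (Fin nF → Carrier) → Pred (Fin nF) 0ℓ
  support w f = ¬ (w f ≈ 0#)

  -- circuits of the matroid with circuit space InSpan:
  -- the minimal nonempty supports of vectors of the span
  KCircuit : Pred (Fin nF) 0ℓ → Set
  KCircuit X =
    (∃ λ w → InSpan w × support w ⊆ X × X ⊆ support w)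
    × (∃ λ f → X f)
    × (∀ w → InSpan w → (∃ λ f → support w f) → support w ⊆ X → X ⊆ support w)

  KIndep : Pred (Fin nF) 0ℓ → Set₁
  KIndep X = ∀ (Z : Pred (Fin nF) 0ℓ) → KCircuit Z → ¬ (Z ⊆ X)

module _ (C : GSC) where
  open GSC C

  LinkV : Fin nV → Set
  LinkV v = Σ (Fin nE) (λ e → T (atE C v e))

  LinkE : Fin nV → Set
  LinkE v = Σ (Fin nF) (λ f → T (atF C v f))

  -- L(v): vertices = edges at v, edges = faces at v; a face f at v joins
  -- the two (distinct) edges of f at v
  Link : Fin nV → Graph
  Link v = record
    { V = LinkV v
    ; E = LinkE v
    ; Joins = λ f e₁ e₂ → (Σ.proj₁ e₁ ≢ Σ.proj₁ e₂) × T (inF C (Σ.proj₁ e₁) (Σ.proj₁ f)) × T (inF C (Σ.proj₁ e₂) (Σ.proj₁ f))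
    }

  LocallyTwoConnected : Set
  LocallyTwoConnected = ∀ v → TwoConnected (Link v)

  faceImage : ∀ v → Pred (LinkE v) 0ℓ → Pred (Fin nF) 0ℓ
  faceImage v X f = Σ (T (atF C v f)) (λ p → X (f , p))

  -- k-local: for every vertex v, the dual of the cycle matroid of L(v)
  -- equals the restriction of the k-dual matroid to the faces at v
  -- (independent sets of the restriction = independent sets of the
  -- k-dual matroid consisting of faces at v)
  KLocal : Field → Set₁
  KLocal k = ∀ v → ∀ (X : Pred (LinkE v) 0ℓ) →
    (DualIndep (CycleIndep (Link v)) X → KIndep k C (faceImage v X))
    × (KIndep k C (faceImage v X) → DualIndep (CycleIndep (Link v)) X)

record FaceGraph (C : GSC) : Set where
  field
    nG : ℕ
    end₁ end₂ : Fin (GSC.nF C) → Fin nG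

  asGraph : Graph
  asGraph = record
    { V = Fin nG
    ; E = Fin (GSC.nF C)
    ; Joins = λ f u w → SameEnds (end₁ f) (end₂ f) u w
    }

  sparseCount : Fin nG → Fin (GSC.nE C) → ℕ
  sparseCount v e = count (GSC.nF C) (λ f → inF C e f ∧ (does (end₁ f ≟ v) ∨ does (end₂ f ≟ v)))

-- Fix an edge e of C with tail x.  In the link graph L(x) the faces containing e form the
-- star of the vertex e, and L(x) has no loops, so a cycle through e leaves it along two star
-- edges: no basis of the cycle matroid of L(x) avoids the whole star, i.e. the star is
-- dependent in the dual.  On the other hand L(x) - e is connected, so a maximal forest of
-- L(x) - e together with any single star edge f is a spanning tree, and the star minus f is
-- independent in the dual.  By k-locality and the hypothesis on G, the faces at e thus form a
-- circuit of the cycle matroid of G, i.e. the edge set of a cycle of G, which has at least two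
-- edges since L(x) is 2-connected.  A cycle meets every vertex in zero or two edges.
-- Maximal forests exist only under double negation here, which suffices because the
-- conclusion is decidable.

module Submission where

open import Defs
open import Level using (0ℓ)
open import Data.Nat using (ℕ; zero; suc; _<_; _≤_; z≤n; s≤s) renaming (_≟_ to _≟ℕ_)
open import Data.Nat.Properties using (<-irrefl; 1+n≢n)
open import Data.Fin using (Fin; zero; suc; toℕ; inject₁; fromℕ; _≟_)
open import Data.Fin.Properties using (toℕ-inject₁; suc-injective; 0≢1+n; any?)
open import Data.Bool using (Bool; true; false; T; _∨_; _∧_; not)
open import Data.Bool.Properties using (T-∨; T-∧; T-irrelevant)
open import Data.Product using (Σ; ∃; _×_; _,_; proj₁; proj₂)
open import Data.Sum using (_⊎_; inj₁; inj₂; [_,_]′)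
import Data.Sum
open import Data.Empty using (⊥; ⊥-elim)
open import Data.Unit using (⊤; tt)
open import Data.List using (List; []; _∷_; allFin)
open import Data.List.Membership.Propositional using (_∈_)
open import Data.List.Membership.Propositional.Properties using (∈-allFin)
open import Data.List.Relation.Unary.Any using (here; there)
open import Effect.Monad using (RawMonad)
open import Function using (Equivalence; _∘_; _$_)
open import Relation.Nullary using (¬_; Dec; yes; no; does)
open import Relation.Nullary.Decidable using (_⊎-dec_; decidable-stable; map′; T?; ¬¬-excluded-middle)
open import Relation.Nullary.Negation using (DoubleNegation; ¬¬-Monad; ¬¬-map)
open import Relation.Unary using (Pred; _⊆_)
open import Relation.Binary.Definitions using (DecidableEquality)
open import Relation.Binary.PropositionalEquality using (_≡_; _≢_; refl; sym; trans; cong; subst; subst₂)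
open import Relation.Binary.Construct.Closure.ReflexiveTransitive using (Star; ε; _◅_; _◅◅_; reverse)

open RawMonad (¬¬-Monad {0ℓ})
open Equivalence using (to; from)

private variable
  A : Set
  n : ℕ

fromDoes : (a? : Dec A) → T (does a?) → A
fromDoes (yes a) _ = a

toDoes : (a? : Dec A) → A → T (does a?)
toDoes (yes _) _ = tt
toDoes (no ¬a) a = ¬a a

T-not⇒¬T : ∀ {b} → T (not b) → ¬ T b
T-not⇒¬T {true} ()

¬T⇒T-not : ∀ {b} → ¬ T b → T (not b)
¬T⇒T-not {true} ¬t = ¬t tt
¬T⇒T-not {false} _ = tt

anyFin3-elim : ∀ p → T (anyFin3 p) → ∃ λ i → T (p i)
anyFin3-elim p t with to (T-∨ {p zero}) t
... | inj₁ t₀ = zero , t₀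
... | inj₂ t′ with to (T-∨ {p (suc zero)}) t′
...   | inj₁ t₁ = suc zero , t₁
...   | inj₂ t₂ = suc (suc zero) , t₂

anyFin3-intro : ∀ p i → T (p i) → T (anyFin3 p)
anyFin3-intro p zero t = from (T-∨ {p zero}) (inj₁ t)
anyFin3-intro p (suc zero) t = from (T-∨ {p zero}) (inj₂ (from (T-∨ {p (suc zero)}) (inj₁ t)))
anyFin3-intro p (suc (suc zero)) t = from (T-∨ {p zero}) (inj₂ (from (T-∨ {p (suc zero)}) (inj₂ t)))

count-none : ∀ n (p : Fin n → Bool) → (∀ i → ¬ T (p i)) → count n p ≡ 0
count-none zero p none = refl
count-none (suc n) p none with p zero | none zero
... | true  | ¬t = ⊥-elim (¬t tt)
... | false | _  = count-none n (p ∘ suc) (none ∘ suc)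

count-one : ∀ n (p : Fin n → Bool) a → T (p a) → (∀ i → T (p i) → i ≡ a) → count n p ≡ 1
count-one (suc n) p zero pa only with p zero
... | true = cong suc (count-none n (p ∘ suc) λ i t → 0≢1+n (sym (only (suc i) t)))
count-one (suc n) p (suc a) pa only with p zero | only zero
... | true  | only₀ = ⊥-elim (0≢1+n (only₀ tt))
... | false | _ = count-one n (p ∘ suc) a pa (λ i t → suc-injective (only (suc i) t))

count-two : ∀ n (p : Fin n → Bool) a b → a ≢ b → T (p a) → T (p b) →
            (∀ i → T (p i) → i ≡ a ⊎ i ≡ b) → count n p ≡ 2
count-two (suc n) p zero zero a≢b _ _ _ = ⊥-elim (a≢b refl)
count-two (suc n) p zero (suc b) _ pa pb only with p zero
... | true = cong suc (count-one n (p ∘ suc) b pb λ i t →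
               [ (λ e → ⊥-elim (0≢1+n (sym e))) , suc-injective ]′ (only (suc i) t))
count-two (suc n) p (suc a) zero _ pa pb only with p zero
... | true = cong suc (count-one n (p ∘ suc) a pa λ i t →
               [ suc-injective , (λ e → ⊥-elim (0≢1+n (sym e))) ]′ (only (suc i) t))
count-two (suc n) p (suc a) (suc b) a≢b pa pb only with p zero | only zero
... | true  | only₀ = ⊥-elim ([ 0≢1+n , 0≢1+n ]′ (only₀ tt))
... | false | _ = count-two n (p ∘ suc) a b (a≢b ∘ cong suc) pa pb λ i t →
                    Data.Sum.map suc-injective suc-injective (only (suc i) t)

module _ {A : Set} where

  SameEnds-sym : {a b c d : A} → SameEnds a b c d → SameEnds c d a b
  SameEnds-sym (inj₁ (refl , refl)) = inj₁ (refl , refl)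
  SameEnds-sym (inj₂ (refl , refl)) = inj₂ (refl , refl)

  SameEnds-trans : {a b c d e f : A} → SameEnds a b c d → SameEnds c d e f → SameEnds a b e f
  SameEnds-trans (inj₁ (refl , refl)) q = q
  SameEnds-trans (inj₂ (refl , refl)) (inj₁ (refl , refl)) = inj₂ (refl , refl)
  SameEnds-trans (inj₂ (refl , refl)) (inj₂ (refl , refl)) = inj₁ (refl , refl)

  SameEnds-∈ : {a b c d y : A} → SameEnds a b c d → y ≡ a ⊎ y ≡ b → y ≡ c ⊎ y ≡ d
  SameEnds-∈ (inj₁ (refl , refl)) y∈ = y∈
  SameEnds-∈ (inj₂ (refl , refl)) y∈ = Data.Sum.swap y∈

SameEnds-injective : ∀ {A B : Set} {φ : A → B} → (∀ {a b} → φ a ≡ φ b → a ≡ b) →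
                     ∀ {a b c d} → SameEnds (φ a) (φ b) (φ c) (φ d) → SameEnds a b c d
SameEnds-injective inj (inj₁ (p , q)) = inj₁ (inj p , inj q)
SameEnds-injective inj (inj₂ (p , q)) = inj₂ (inj p , inj q)

nx≢ : ∀ k → nx k ≢ k
nx≢ zero ()
nx≢ (suc zero) ()
nx≢ (suc (suc zero)) ()

nx²≢ : ∀ k → nx (nx k) ≢ k
nx²≢ zero ()
nx²≢ (suc zero) ()
nx²≢ (suc (suc zero)) ()

≢⇒nx⊎nx² : ∀ {k m} → m ≢ k → m ≡ nx k ⊎ m ≡ nx (nx k)
≢⇒nx⊎nx² {zero} {zero} m≢k = ⊥-elim (m≢k refl)
≢⇒nx⊎nx² {zero} {suc zero} _ = inj₁ refl
≢⇒nx⊎nx² {zero} {suc (suc zero)} _ = inj₂ refl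
≢⇒nx⊎nx² {suc zero} {zero} _ = inj₂ refl
≢⇒nx⊎nx² {suc zero} {suc zero} m≢k = ⊥-elim (m≢k refl)
≢⇒nx⊎nx² {suc zero} {suc (suc zero)} _ = inj₁ refl
≢⇒nx⊎nx² {suc (suc zero)} {zero} _ = inj₁ refl
≢⇒nx⊎nx² {suc (suc zero)} {suc zero} _ = inj₂ refl
≢⇒nx⊎nx² {suc (suc zero)} {suc (suc zero)} m≢k = ⊥-elim (m≢k refl)

third-index : ∀ {i m} → i ≢ m → ∃ λ k → k ≢ i × k ≢ m
third-index {i} {m} i≢m with ≢⇒nx⊎nx² i≢m
... | inj₁ refl = nx (nx m) , nx≢ (nx m) , nx²≢ m
... | inj₂ refl = nx m , (λ e → nx≢ (nx m) (sym e)) , nx≢ m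

fin3-pigeonhole : ∀ {i j k m : Fin 3} → i ≢ m → j ≢ m → k ≢ m → i ≢ j → k ≡ i ⊎ k ≡ j
fin3-pigeonhole i≢m j≢m k≢m i≢j with ≢⇒nx⊎nx² i≢m | ≢⇒nx⊎nx² j≢m | ≢⇒nx⊎nx² k≢m
... | inj₁ refl | inj₁ refl | _         = ⊥-elim (i≢j refl)
... | inj₂ refl | inj₂ refl | _         = ⊥-elim (i≢j refl)
... | inj₁ refl | inj₂ refl | inj₁ refl = inj₁ refl
... | inj₁ refl | inj₂ refl | inj₂ refl = inj₂ refl
... | inj₂ refl | inj₁ refl | inj₁ refl = inj₂ refl
... | inj₂ refl | inj₁ refl | inj₂ refl = inj₁ refl

opposite-pair-injective : ∀ i j → SameEnds (nx i) (nx (nx i)) (nx j) (nx (nx j)) → i ≡ j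
opposite-pair-injective zero zero _ = refl
opposite-pair-injective zero (suc zero) (inj₁ (() , _))
opposite-pair-injective zero (suc zero) (inj₂ (() , _))
opposite-pair-injective zero (suc (suc zero)) (inj₁ (() , _))
opposite-pair-injective zero (suc (suc zero)) (inj₂ (_ , ()))
opposite-pair-injective (suc zero) zero (inj₁ (() , _))
opposite-pair-injective (suc zero) zero (inj₂ (_ , ()))
opposite-pair-injective (suc zero) (suc zero) _ = refl
opposite-pair-injective (suc zero) (suc (suc zero)) (inj₁ (() , _))
opposite-pair-injective (suc zero) (suc (suc zero)) (inj₂ (() , _))
opposite-pair-injective (suc (suc zero)) zero (inj₁ (() , _))
opposite-pair-injective (suc (suc zero)) zero (inj₂ (() , _))
opposite-pair-injective (suc (suc zero)) (suc zero) (inj₁ (() , _))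
opposite-pair-injective (suc (suc zero)) (suc zero) (inj₂ (_ , ()))
opposite-pair-injective (suc (suc zero)) (suc (suc zero)) _ = refl

avoid-two : ∀ {V : Set} → DecidableEquality V → ∀ {a b c} → a ≢ b → a ≢ c → b ≢ c →
            ∀ u v → ∃ λ z → z ≢ u × z ≢ v
avoid-two _≟V_ {a} {b} {c} a≢b a≢c b≢c u v with a ≟V u | a ≟V v
... | no a≢u | no a≢v = a , a≢u , a≢v
... | yes refl | _ with b ≟V v
...   | yes refl = c , (a≢c ∘ sym) , (b≢c ∘ sym)
...   | no b≢v = b , (a≢b ∘ sym) , b≢v
avoid-two _≟V_ {a} {b} {c} a≢b a≢c b≢c u v | no _ | yes refl with b ≟V u
...   | yes refl = c , (b≢c ∘ sym) , (a≢c ∘ sym)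
...   | no b≢u = b , b≢u , (a≢b ∘ sym)

shift : Fin (suc n) → Fin (suc (suc n))
shift zero = zero
shift (suc j) = suc (suc j)

next : Fin (suc n) → Fin (suc n)
next {zero} zero = zero
next {suc n} zero = suc zero
next {suc n} (suc i) = shift (next i)

prev : Fin (suc n) → Fin (suc n)
prev {n} zero = fromℕ n
prev {suc n} (suc k) = inject₁ k

next-inject₁ : (k : Fin n) → next (inject₁ k) ≡ suc k
next-inject₁ {suc n} zero = refl
next-inject₁ {suc n} (suc k) = cong shift (next-inject₁ k)

next-fromℕ : ∀ n → next (fromℕ n) ≡ zero
next-fromℕ zero = refl
next-fromℕ (suc n) = cong shift (next-fromℕ n)

inject₁⊎fromℕ : (i : Fin (suc n)) → (∃ λ k → i ≡ inject₁ k) ⊎ i ≡ fromℕ n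
inject₁⊎fromℕ {zero} zero = inj₂ refl
inject₁⊎fromℕ {suc n} zero = inj₁ (zero , refl)
inject₁⊎fromℕ {suc n} (suc i) with inject₁⊎fromℕ i
... | inj₁ (k , refl) = inj₁ (suc k , refl)
... | inj₂ refl = inj₂ refl

prev-suc : (k : Fin n) → prev (suc k) ≡ inject₁ k
prev-suc {suc n} k = refl

prev-next : (i : Fin (suc n)) → prev (next i) ≡ i
prev-next {n} i with inject₁⊎fromℕ i
... | inj₁ (k , refl) rewrite next-inject₁ k = prev-suc k
... | inj₂ refl rewrite next-fromℕ n = refl

next-prev : (j : Fin (suc n)) → next (prev j) ≡ j
next-prev {n} zero = next-fromℕ n
next-prev {suc n} (suc k) = next-inject₁ k

prev≢ : (j : Fin (suc (suc n))) → prev j ≢ j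
prev≢ zero ()
prev≢ (suc k) e = 1+n≢n (trans (sym (cong toℕ e)) (toℕ-inject₁ k))

prev-fixpoint-free : {a b : Fin (suc n)} → a ≢ b → (j : Fin (suc n)) → prev j ≢ j
prev-fixpoint-free {zero} {zero} {zero} a≢b = ⊥-elim (a≢b refl)
prev-fixpoint-free {suc n} _ = prev≢

next-fixpoint-free : {a b : Fin (suc n)} → a ≢ b → (j : Fin (suc n)) → next j ≢ j
next-fixpoint-free a≢b j e = prev-fixpoint-free a≢b j (trans (cong prev (sym e)) (prev-next j))

module _ (G : Graph) where
  open Graph G

  EndsUnique : Set
  EndsUnique = ∀ h {a b c d} → Joins h a b → Joins h c d → SameEnds a b c d

  Loopless : Set
  Loopless = ∀ h {a b} → Joins h a b → a ≢ b

  JoinsSymmetric : Set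
  JoinsSymmetric = ∀ h {a b} → Joins h a b → Joins h b a

module _ {G : Graph} {X Y : Pred (Graph.E G) 0ℓ} where

  CycleIndep-antitone : X ⊆ Y → CycleIndep G Y → CycleIndep G X
  CycleIndep-antitone X⊆Y indY c c⊆X = indY c (X⊆Y ∘ c⊆X)

DualIndep-antitone : ∀ {E : Set} {a} {I : Pred E 0ℓ → Set a} {X Y : Pred E 0ℓ} →
                     X ⊆ Y → DualIndep I Y → DualIndep I X
DualIndep-antitone X⊆Y (B , basis , B∩Y=∅) = B , basis , λ g g∈B g∈X → B∩Y=∅ g g∈B (X⊆Y g∈X)

module Walks (G : Graph) where
  open Graph G

  Step : Pred E 0ℓ → V → V → Set
  Step Q a b = ∃ λ h → Q h × Joins h a b

  Walk : Pred E 0ℓ → V → V → Set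
  Walk Q = Star (Step Q)

  module _ {Q : Pred E 0ℓ} where

    walk-prefix : (vs : Fin (suc n) → V) (es : Fin n → E) →
                  (∀ k → Joins (es k) (vs (inject₁ k)) (vs (suc k))) →
                  ∀ i → (∀ k → toℕ k < toℕ i → Q (es k)) → Walk Q (vs zero) (vs i)
    walk-prefix vs es step zero q = ε
    walk-prefix {suc n} vs es step (suc i) q =
      (es zero , q zero (s≤s z≤n) , step zero)
      ◅ walk-prefix (vs ∘ suc) (es ∘ suc) (step ∘ suc) i (λ k k<i → q (suc k) (s≤s k<i))

    walk-suffix : (vs : Fin (suc n) → V) (es : Fin n → E) →
                  (∀ k → Joins (es k) (vs (inject₁ k)) (vs (suc k))) →
                  ∀ i → (∀ k → toℕ i ≤ toℕ k → Q (es k)) → Walk Q (vs i) (vs (fromℕ n))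
    walk-suffix {n} vs es step zero q = walk-prefix vs es step (fromℕ n) (λ k _ → q k z≤n)
    walk-suffix {suc n} vs es step (suc i) q =
      walk-suffix (vs ∘ suc) (es ∘ suc) (step ∘ suc) i (λ k i≤k → q (suc k) (s≤s i≤k))

  module CycleOrder (c : Cycle G) where
    open Cycle c

    vtx : Fin (suc len) → V
    vtx i = vs (inject₁ i)

    vs-suc : ∀ i → vs (suc i) ≡ vtx (next i)
    vs-suc i with inject₁⊎fromℕ i
    ... | inj₁ (k , refl) rewrite next-inject₁ k = refl
    ... | inj₂ refl rewrite next-fromℕ len = closed

    joins-next : ∀ i → Joins (es i) (vtx i) (vtx (next i))
    joins-next i = subst (Joins (es i) (vtx i)) (vs-suc i) (step i)

    walk-around : {Q : Pred E 0ℓ} (j : Fin (suc len)) → (∀ k → k ≢ j → Q (es k)) →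
                  Walk Q (vtx (next j)) (vtx j)
    walk-around j q =
      subst₂ (Walk _) (vs-suc j) refl (walk-suffix vs es step (suc j) after-j)
      ◅◅ subst₂ (Walk _) (sym closed) refl (walk-prefix vs es step (inject₁ j) before-j)
      where
        after-j : ∀ k → suc (toℕ j) ≤ toℕ k → _
        after-j k j<k = q k λ { refl → <-irrefl refl j<k }
        before-j : ∀ k → toℕ k < toℕ (inject₁ j) → _
        before-j k k<j = q k λ { refl → <-irrefl (sym (toℕ-inject₁ k)) k<j }

module SimplePaths (G : Graph) (_≟V_ : DecidableEquality (Graph.V G)) (ends-unique : EndsUnique G)
  (Q : Pred (Graph.E G) 0ℓ) where
  open Graph G
  open Walks G

  data Path : V → V → Set where
    [] : ∀ {a} → Path a a
    step : ∀ {a b c} (h : E) → Q h → Joins h a b → Path b c → Path a c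

  OnPath : ∀ {a b} → V → Path a b → Set
  OnPath v ([] {a}) = v ≡ a
  OnPath v (step {a} _ _ _ p) = v ≡ a ⊎ OnPath v p

  Simple : ∀ {a b} → Path a b → Set
  Simple [] = ⊤
  Simple (step {a} _ _ _ p) = ¬ OnPath a p × Simple p

  SimplePath : V → V → Set
  SimplePath a b = Σ (Path a b) Simple

  onPath? : ∀ {a b} v (p : Path a b) → Dec (OnPath v p)
  onPath? v ([] {a}) = v ≟V a
  onPath? v (step {a} _ _ _ p) = (v ≟V a) ⊎-dec onPath? v p

  simple-suffix : ∀ {a b c} (p : Path b c) → OnPath a p → Simple p → SimplePath a c
  simple-suffix [] refl s = [] , s
  simple-suffix (step h q j p) (inj₁ refl) s = step h q j p , s
  simple-suffix (step h q j p) (inj₂ a∈p) s = simple-suffix p a∈p (proj₂ s)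

  walk⇒simple-path : ∀ {a c} → Walk Q a c → SimplePath a c
  walk⇒simple-path ε = [] , _
  walk⇒simple-path {a} ((h , q , j) ◅ w) with walk⇒simple-path w
  ... | p , s with onPath? a p
  ...   | yes a∈p = simple-suffix p a∈p s
  ...   | no a∉p  = step h q j p , a∉p , s

  on-path-invariant : (P : Pred V 0ℓ) → (∀ {h a b} → Q h → Joins h a b → P b) →
                      ∀ {a b} → P a → (p : Path a b) → ∀ v → OnPath v p → P v
  on-path-invariant P step-P Pa [] v refl = Pa
  on-path-invariant P step-P Pa (step h q j p) v (inj₁ refl) = Pa
  on-path-invariant P step-P Pa (step h q j p) v (inj₂ v∈p) = on-path-invariant P step-P (step-P q j) p v v∈p

  private
    length : ∀ {a b} → Path a b → ℕ
    length [] = 0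
    length (step _ _ _ p) = suc (length p)

    -- the vertices and edges of p followed by an edge g back to the vertex c
    closed-vs : ∀ {a b} (c : V) (p : Path a b) → Fin (suc (suc (length p))) → V
    closed-vs c ([] {a}) zero = a
    closed-vs c [] (suc zero) = c
    closed-vs c (step {a} _ _ _ p) zero = a
    closed-vs c (step _ _ _ p) (suc i) = closed-vs c p i

    closed-es : ∀ {a b} (g : E) (p : Path a b) → Fin (suc (length p)) → E
    closed-es g [] zero = g
    closed-es g (step h _ _ p) zero = h
    closed-es g (step _ _ _ p) (suc i) = closed-es g p i

    closed-vs-last : ∀ {a b} c (p : Path a b) → closed-vs c p (fromℕ (suc (length p))) ≡ c
    closed-vs-last c [] = refl
    closed-vs-last c (step _ _ _ p) = closed-vs-last c p

    closed-vs-zero : ∀ {a b} c (p : Path a b) → closed-vs c p zero ≡ a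
    closed-vs-zero c [] = refl
    closed-vs-zero c (step _ _ _ p) = refl

    closed-step : ∀ {a b} c g (p : Path a b) → Joins g b c →
                  ∀ i → Joins (closed-es g p i) (closed-vs c p (inject₁ i)) (closed-vs c p (suc i))
    closed-step c g [] jg zero = jg
    closed-step c g (step h q j p) jg zero = subst (Joins h _) (sym (closed-vs-zero c p)) j
    closed-step c g (step h q j p) jg (suc i) = closed-step c g p jg i

    on-path : ∀ {a b} c (p : Path a b) i → OnPath (closed-vs c p (inject₁ i)) p
    on-path c [] zero = refl
    on-path c (step _ _ _ p) zero = inj₁ refl
    on-path c (step _ _ _ p) (suc i) = inj₂ (on-path c p i)

    on-path-or-end : ∀ {a b} c (p : Path a b) i → OnPath (closed-vs c p i) p ⊎ closed-vs c p i ≡ c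
    on-path-or-end c [] zero = inj₁ refl
    on-path-or-end c [] (suc zero) = inj₂ refl
    on-path-or-end c (step _ _ _ p) zero = inj₁ (inj₁ refl)
    on-path-or-end c (step _ _ _ p) (suc i) = Data.Sum.map₁ inj₂ (on-path-or-end c p i)

    closed-vs-injective : ∀ {a b} c (p : Path a b) → Simple p →
                          ∀ {i j} → closed-vs c p (inject₁ i) ≡ closed-vs c p (inject₁ j) → i ≡ j
    closed-vs-injective c [] _ {zero} {zero} _ = refl
    closed-vs-injective c (step _ _ _ p) _ {zero} {zero} _ = refl
    closed-vs-injective c (step _ _ _ p) s {zero} {suc j} e = ⊥-elim (proj₁ s (subst (λ z → OnPath z p) (sym e) (on-path c p j)))
    closed-vs-injective c (step _ _ _ p) s {suc i} {zero} e = ⊥-elim (proj₁ s (subst (λ z → OnPath z p) e (on-path c p i)))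
    closed-vs-injective c (step _ _ _ p) s {suc i} {suc j} e = cong suc (closed-vs-injective c p (proj₂ s) e)

    closed-es-last⊎Q : ∀ {a b} g (p : Path a b) i → closed-es g p i ≡ g ⊎ Q (closed-es g p i)
    closed-es-last⊎Q g [] zero = inj₁ refl
    closed-es-last⊎Q g (step h q j p) zero = inj₂ q
    closed-es-last⊎Q g (step h q j p) (suc i) = closed-es-last⊎Q g p i

    -- an edge of a simple path that reappears later would join its start to a later vertex
    closed-es-injective : ∀ {a b} c g (p : Path a b) → Simple p → Joins g b c → ¬ Q g → (∀ v → OnPath v p → v ≢ c) →
                          ∀ {i j} → closed-es g p i ≡ closed-es g p j → i ≡ j
    closed-es-injective c g [] _ _ _ _ {zero} {zero} _ = refl
    closed-es-injective c g (step _ _ _ p) _ _ _ _ {zero} {zero} _ = refl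
    closed-es-injective c g (step {a} h q j p) s jg g∉Q c∉p {zero} {suc i} e
      with closed-es-last⊎Q g p i
    ... | inj₁ e′ = ⊥-elim (g∉Q (subst Q (trans e e′) q))
    ... | inj₂ _ with ends-unique h j (subst (λ z → Joins z _ _) (sym e) (closed-step c g p jg i))
    ...   | inj₁ (a≡ , _) = ⊥-elim (proj₁ s (subst (λ z → OnPath z p) (sym a≡) (on-path c p i)))
    ...   | inj₂ (a≡ , _) with on-path-or-end c p (suc i)
    ...     | inj₁ a∈p = ⊥-elim (proj₁ s (subst (λ z → OnPath z p) (sym a≡) a∈p))
    ...     | inj₂ a≡c = ⊥-elim (c∉p a (inj₁ refl) (trans a≡ a≡c))
    closed-es-injective c g (step h q j p) s jg g∉Q c∉p {suc i} {zero} e =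
      sym (closed-es-injective c g (step h q j p) s jg g∉Q c∉p {zero} {suc i} (sym e))
    closed-es-injective c g (step _ _ _ p) s jg g∉Q c∉p {suc i} {suc i′} e =
      cong suc (closed-es-injective c g p (proj₂ s) jg g∉Q (λ v v∈p → c∉p v (inj₂ v∈p)) e)

  close-path : ∀ {a b} (c : V) (g₁ g₂ : E) (p : Path a b) → Simple p → (∀ v → OnPath v p → v ≢ c) →
               Joins g₁ c a → Joins g₂ b c → g₁ ≢ g₂ → ¬ Q g₁ → ¬ Q g₂ →
               Σ (Cycle G) λ cy → cycleEdges G cy ⊆ λ h → Q h ⊎ h ≡ g₁ ⊎ h ≡ g₂
  close-path c g₁ g₂ p s c∉p j₁ j₂ g₁≢g₂ g₁∉Q g₂∉Q = cycle , edges
    where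
      vs : Fin (suc (suc (suc (length p)))) → V
      vs zero = c
      vs (suc i) = closed-vs c p i

      es : Fin (suc (suc (length p))) → E
      es zero = g₁
      es (suc i) = closed-es g₂ p i

      joins : ∀ i → Joins (es i) (vs (inject₁ i)) (vs (suc i))
      joins zero = subst (Joins g₁ c) (sym (closed-vs-zero c p)) j₁
      joins (suc i) = closed-step c g₂ p j₂ i

      g₁-not-later : ∀ i → g₁ ≢ closed-es g₂ p i
      g₁-not-later i e with closed-es-last⊎Q g₂ p i
      ... | inj₁ e′ = g₁≢g₂ (trans e e′)
      ... | inj₂ q = g₁∉Q (subst Q (sym e) q)

      es-injective : ∀ {i j} → es i ≡ es j → i ≡ j
      es-injective {zero} {zero} _ = refl
      es-injective {zero} {suc j} e = ⊥-elim (g₁-not-later j e)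
      es-injective {suc i} {zero} e = ⊥-elim (g₁-not-later i (sym e))
      es-injective {suc i} {suc j} e = cong suc (closed-es-injective c g₂ p s j₂ g₂∉Q c∉p e)

      vs-injective : ∀ {i j} → vs (inject₁ i) ≡ vs (inject₁ j) → i ≡ j
      vs-injective {zero} {zero} _ = refl
      vs-injective {zero} {suc j} e = ⊥-elim (c∉p _ (on-path c p j) (sym e))
      vs-injective {suc i} {zero} e = ⊥-elim (c∉p _ (on-path c p i) e)
      vs-injective {suc i} {suc j} e = cong suc (closed-vs-injective c p s e)

      cycle : Cycle G
      cycle = record { len = suc (length p) ; vs = vs ; es = es ; closed = closed-vs-last c p
                     ; step = joins ; es-inj = es-injective ; vs-inj = vs-injective }

      edges : cycleEdges G cycle ⊆ λ h → Q h ⊎ h ≡ g₁ ⊎ h ≡ g₂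
      edges (zero , refl) = inj₂ (inj₁ refl)
      edges (suc i , refl) with closed-es-last⊎Q g₂ p i
      ... | inj₁ e = inj₂ (inj₂ e)
      ... | inj₂ q = inj₁ q

insert : (Fin n → Bool) → Fin n → Fin n → Bool
insert b i j = b j ∨ does (j ≟ i)

module _ (b : Fin n → Bool) (i : Fin n) where

  ∈-insert⁻ : ∀ j → T (insert b i j) → T (b j) ⊎ j ≡ i
  ∈-insert⁻ j t = Data.Sum.map₂ (fromDoes (j ≟ i)) (to (T-∨ {b j}) t)

  ∈-insert⁺ : ∀ {j} → T (b j) → T (insert b i j)
  ∈-insert⁺ {j} t = from (T-∨ {b j}) (inj₁ t)

  ∈-insert-new : T (insert b i i)
  ∈-insert-new = from (T-∨ {b i}) (inj₂ (toDoes (i ≟ i) refl))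

-- Classically a greedy pass over Fin n; the choices at each step are
-- undecidable, so the existence of the result is only doubly negated.
module MaximalSubset {n : ℕ} (Ind : (Fin n → Bool) → Set)
  (Ind-antitone : ∀ {b b′} → (∀ i → T (b i) → T (b′ i)) → Ind b′ → Ind b)
  (Ind-empty : Ind (λ _ → false)) (A : Fin n → Bool) where

  MaximalOn : List (Fin n) → (Fin n → Bool) → Set
  MaximalOn L b = (∀ i → T (b i) → T (A i)) × Ind b ×
                  (∀ i → i ∈ L → T (A i) → ¬ T (b i) → ¬ Ind (insert b i))

  private
    extend : ∀ h L b → MaximalOn L b → Dec (Ind (insert b h)) → Dec (T (A h)) → Σ _ (MaximalOn (h ∷ L))
    extend h L b (b⊆A , ind , max) (yes ind′) (yes h∈A) = insert b h , b′⊆A , ind′ , max′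
      where
        b′⊆A : ∀ i → T (insert b h i) → T (A i)
        b′⊆A i t = [ b⊆A i , (λ { refl → h∈A }) ]′ (∈-insert⁻ b h i t)
        max′ : ∀ i → i ∈ h ∷ L → T (A i) → ¬ T (insert b h i) → ¬ Ind (insert (insert b h) i)
        max′ i (here refl) _ i∉b′ _ = i∉b′ (∈-insert-new b i)
        max′ i (there i∈L) i∈A i∉b′ ind″ = max i i∈L i∈A (i∉b′ ∘ ∈-insert⁺ b h)
          (Ind-antitone (λ j t → [ ∈-insert⁺ (insert b h) i ∘ ∈-insert⁺ b h , (λ { refl → ∈-insert-new (insert b h) j }) ]′
                                   (∈-insert⁻ b i j t)) ind″)
    extend h L b (b⊆A , ind , max) (yes _) (no h∉A) = b , b⊆A , ind , λ
      { i (here refl) i∈A → ⊥-elim (h∉A i∈A)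
      ; i (there i∈L) → max i i∈L }
    extend h L b (b⊆A , ind , max) (no ¬ind) _ = b , b⊆A , ind , λ
      { i (here refl) _ _ → ¬ind
      ; i (there i∈L) → max i i∈L }

  maximal-on : ∀ L → DoubleNegation (Σ _ (MaximalOn L))
  maximal-on [] = pure ((λ _ → false) , (λ _ ()) , Ind-empty , λ _ ())
  maximal-on (h ∷ L) = do
    (b , m) ← maximal-on L
    ind? ← ¬¬-excluded-middle
    pure (extend h L b m ind? (T? (A h)))

  maximal-subset : DoubleNegation (Σ (Fin n → Bool) λ b → (∀ i → T (b i) → T (A i)) × Ind b ×
                                   (∀ i → T (A i) → ¬ T (b i) → ¬ Ind (insert b i)))
  maximal-subset = do
    (b , b⊆A , ind , max) ← maximal-on (allFin n)
    pure (b , b⊆A , ind , λ i → max i (∈-allFin i))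

module VertexStar (G : Graph) (_≟V_ : DecidableEquality (Graph.V G)) (ends-unique : EndsUnique G)
  (loopless : Loopless G) (joins-sym : JoinsSymmetric G) (u : Graph.V G) where
  open Graph G
  open Walks G

  AtU : Pred E 0ℓ
  AtU h = ∃ λ w → Joins h u w

  module _ (c : Cycle G) where
    open Cycle c
    open CycleOrder c

    private
      i≢next : ∀ i → i ≢ next i
      i≢next i e = loopless (es i) (joins-next i) (cong vtx e)

    cycle-leaves-u : ∀ i → AtU (es i) → ∃ λ i′ → i′ ≢ i × AtU (es i′)
    cycle-leaves-u i (w , j) with ends-unique (es i) j (joins-next i)
    ... | inj₁ (refl , _) =
      prev i , prev-fixpoint-free (i≢next i) i ,
      _ , joins-sym (es (prev i)) (subst (Joins _ _) (cong vtx (next-prev i)) (joins-next (prev i)))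
    ... | inj₂ (refl , _) = next i , next-fixpoint-free (i≢next i) i , _ , joins-next (next i)

  -- a cycle through an edge at u must leave u again by a second edge at u
  insert-star-edge : {Z : Pred E 0ℓ} → (∀ g → Z g → ¬ AtU g) → CycleIndep G Z →
                     ∀ f → AtU f → CycleIndep G (λ g → Z g ⊎ g ≡ f)
  insert-star-edge {Z} Z∩star=∅ indZ f f∈star c c⊆ = indZ c λ { (i , refl) → in-Z i }
    where
      open Cycle c
      in-Z : ∀ i → Z (es i)
      in-Z i with c⊆ (i , refl)
      ... | inj₁ z = z
      ... | inj₂ eᵢ≡f with cycle-leaves-u c i (subst AtU (sym eᵢ≡f) f∈star)
      ...   | i′ , i′≢i , i′∈star with c⊆ (i′ , refl)
      ...     | inj₁ z = ⊥-elim (Z∩star=∅ _ z i′∈star)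
      ...     | inj₂ eᵢ′≡f = ⊥-elim (i′≢i (es-inj (trans eᵢ′≡f (sym eᵢ≡f))))

  no-basis-avoids-star : ∀ f → AtU f → ¬ DualIndep (CycleIndep G) AtU
  no-basis-avoids-star f f∈star (B , (indB , maxB) , B∩star=∅) = B∩star=∅ f f∈B f∈star
    where f∈B = maxB (λ g → B g ⊎ g ≡ f) inj₁ (insert-star-edge B∩star=∅ indB f f∈star) (inj₂ refl)

  another-star-edge : TwoConnected G → ∀ f → AtU f → ∃ λ h → AtU h × h ≢ f
  another-star-edge ((a , b , c , a≢b , a≢c , b≢c) , _ , connected-without) f (w , j)
    with avoid-two _≟V_ a≢b a≢c b≢c u w
  ... | z , z≢u , z≢w with connected-without w u z (loopless f j) z≢w
  ...   | ε = ⊥-elim (z≢u refl)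
  ...   | (_ , u′≢w , h , jh) ◅ _ = h , (_ , jh) , h≢f
    where
      h≢f : h ≢ f
      h≢f refl with ends-unique h j jh
      ... | inj₁ (_ , w≡u′) = u′≢w (sym w≡u′)
      ... | inj₂ (_ , w≡u) = loopless h j (sym w≡u)

  module _ (two-connected : TwoConnected G)
    {n : ℕ} (index : E → Fin n) (index-injective : ∀ {g h} → index g ≡ index h → g ≡ h)
    (off : Fin n → Bool)
    (off-sound : ∀ g → T (off (index g)) → ¬ AtU g)
    (off-complete : ∀ g → ¬ AtU g → T (off (index g))) where

    _∈ˢ_ : E → (Fin n → Bool) → Set
    g ∈ˢ b = T (b (index g))

    Forest : (Fin n → Bool) → Set
    Forest b = CycleIndep G (_∈ˢ b)

    open MaximalSubset Forest (λ sub → CycleIndep-antitone (sub (index _))) (λ c c⊆∅ → c⊆∅ (zero , refl)) off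

    module MaximalForest (t : Fin n → Bool) (t⊆off : ∀ i → T (t i) → T (off i)) (t-forest : Forest t)
                         (t-maximal : ∀ i → T (off i) → ¬ T (t i) → ¬ Forest (insert t i)) where

      InT : Pred E 0ℓ
      InT g = g ∈ˢ t

      t∩star=∅ : ∀ g → InT g → ¬ AtU g
      t∩star=∅ g g∈t = off-sound g (t⊆off (index g) g∈t)

      -- by maximality of t, an edge outside t closes a cycle with t
      edge-ends-connected : ∀ {a b} h → Joins h a b → a ≢ u → b ≢ u → DoubleNegation (Walk InT a b)
      edge-ends-connected {a} {b} h j a≢u b≢u with T? (t (index h))
      ... | yes h∈t = pure ((h , h∈t , j) ◅ ε)
      ... | no h∉t = λ ¬walk → t-maximal (index h) h-off h∉t λ c c⊆ → ¬walk (walk-from-cycle c c⊆)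
        where
          h-off : T (off (index h))
          h-off = off-complete h λ (_ , j′) → [ (λ u≡a → a≢u (sym u≡a)) , (λ u≡b → b≢u (sym u≡b)) ]′ (SameEnds-∈ (ends-unique h j′ j) (inj₁ refl))

          walk-from-cycle : (c : Cycle G) → cycleEdges G c ⊆ (_∈ˢ insert t (index h)) → Walk InT a b
          walk-from-cycle c c⊆ with any? (λ i → index (Cycle.es c i) ≟ index h)
          ... | no h∉c = ⊥-elim (t-forest c λ { (i , refl) →
                  [ (λ eᵢ∈t → eᵢ∈t) , (λ e → ⊥-elim (h∉c (i , e))) ]′ (∈-insert⁻ t (index h) _ (c⊆ (i , refl))) })
          ... | yes (k , eₖ≡h) = orient (ends-unique h j (subst (λ h′ → Joins h′ _ _) (index-injective eₖ≡h) (joins-next k)))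
            where
              open Cycle c
              open CycleOrder c
              others-in-t : ∀ i → i ≢ k → InT (es i)
              others-in-t i i≢k = [ (λ eᵢ∈t → eᵢ∈t) , (λ e → ⊥-elim (i≢k (es-inj (index-injective (trans e (sym eₖ≡h)))))) ]′
                                    (∈-insert⁻ t (index h) _ (c⊆ (i , refl)))
              around : Walk InT (vtx (next k)) (vtx k)
              around = walk-around k others-in-t
              orient : SameEnds a b (vtx k) (vtx (next k)) → Walk InT a b
              orient (inj₁ (a≡ , b≡)) = subst₂ (Walk InT) (sym a≡) (sym b≡)
                                          (reverse (λ (h′ , q , j′) → h′ , q , joins-sym h′ j′) around)
              orient (inj₂ (a≡ , b≡)) = subst₂ (Walk InT) (sym a≡) (sym b≡) around

      connected-in-t : ∀ a b → a ≢ u → b ≢ u → DoubleNegation (Walk InT a b)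
      connected-in-t a b a≢u b≢u = join-steps (proj₂ (proj₂ two-connected) u a b a≢u b≢u)
        where
          join-steps : ∀ {a b} → Star (AdjIn G (λ y → y ≢ u)) a b → DoubleNegation (Walk InT a b)
          join-steps ε = pure ε
          join-steps ((a≢u , b≢u , h , j) ◅ rest) = do
            w₁ ← edge-ends-connected h j a≢u b≢u
            w₂ ← join-steps rest
            pure (w₁ ◅◅ w₂)

      module _ (f : E) {w₀} (j₀ : Joins f u w₀) where

        InB : Pred E 0ℓ
        InB g = g ∈ˢ insert t (index f)

        B-independent : CycleIndep G InB
        B-independent = CycleIndep-antitone
          (λ g∈B → Data.Sum.map₂ index-injective (∈-insert⁻ t (index f) _ g∈B))
          (insert-star-edge t∩star=∅ t-forest f (w₀ , j₀))

        -- a second star edge g closes a cycle with f and a path in t between their other ends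
        star-edge-closes-cycle : ∀ {Y g w} → InB ⊆ Y → CycleIndep G Y → Y g → ¬ InB g → Joins g u w → ⊥
        star-edge-closes-cycle {Y} {g} {w} B⊆Y indY g∈Y g∉B jg =
          connected-in-t w₀ w (λ { refl → loopless f j₀ refl }) (λ { refl → loopless g jg refl }) λ walk →
            let p , simple = walk⇒simple-path walk
                u∉p = on-path-invariant (_≢ u) (λ { h∈t jh refl → t∩star=∅ _ h∈t (_ , joins-sym _ jh) })
                                        (λ { refl → loopless f j₀ refl }) p
                c , c⊆ = close-path u f g p simple u∉p j₀ (joins-sym g jg)
                           (λ { refl → g∉B (∈-insert-new t (index f)) })
                           (λ f∈t → t∩star=∅ f f∈t (_ , j₀)) (g∉B ∘ ∈-insert⁺ t (index f))
            in indY c λ e∈c → [ B⊆Y ∘ ∈-insert⁺ t (index f) , [ (λ { refl → B⊆Y (∈-insert-new t (index f)) }) , (λ { refl → g∈Y }) ]′ ]′ (c⊆ e∈c)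
          where open SimplePaths G _≟V_ ends-unique InT

        B-maximal : ∀ Y → InB ⊆ Y → CycleIndep G Y → Y ⊆ InB
        B-maximal Y B⊆Y indY {g} g∈Y = decidable-stable (T? (insert t (index f) (index g))) λ g∉B →
          t-maximal (index g) (off-complete g λ (_ , jg) → star-edge-closes-cycle B⊆Y indY g∈Y g∉B jg)
                    (g∉B ∘ ∈-insert⁺ t (index f))
                    (CycleIndep-antitone (λ h∈ → [ B⊆Y ∘ ∈-insert⁺ t (index f) , (λ e → subst Y (sym (index-injective e)) g∈Y) ]′
                                                   (∈-insert⁻ t (index g) _ h∈))
                                         indY)

    star-minus-edge-coindependent : ∀ f → AtU f → DoubleNegation (DualIndep (CycleIndep G) (λ g → AtU g × g ≢ f))
    star-minus-edge-coindependent f (_ , j) ¬dual = maximal-subset λ (t , t⊆off , t-forest , t-maximal) →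
      let open MaximalForest t t⊆off t-forest t-maximal
      in ¬dual (InB f j , (B-independent f j , B-maximal f j) , λ g g∈B (g∈star , g≢f) →
           [ (λ g∈t → t∩star=∅ g g∈t g∈star) , g≢f ∘ index-injective ]′ (∈-insert⁻ t (index f) _ g∈B))

dependent⇒cycle : ∀ {G : Graph} {S : Pred (Graph.E G) 0ℓ} → ¬ CycleIndep G S →
                  DoubleNegation (∃ λ c → cycleEdges G c ⊆ S)
dependent⇒cycle dependent no-cycle = dependent λ c c⊆S → no-cycle (c , c⊆S)

circuit⊆cycle : (G : Graph) → DecidableEquality (Graph.E G) → {S : Pred (Graph.E G) 0ℓ} (c : Cycle G) →
                cycleEdges G c ⊆ S → (∀ {f} → S f → DoubleNegation (CycleIndep G (λ g → S g × g ≢ f))) →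
                S ⊆ cycleEdges G c
circuit⊆cycle G _≟E_ c c⊆S S-f-indep {f} f∈S = decidable-stable (any? (λ i → Cycle.es c i ≟E f)) λ f∉c →
  S-f-indep f∈S λ indep → indep c λ { (i , refl) → c⊆S (i , refl) , λ eᵢ≡f → f∉c (i , eᵢ≡f) }

module _ {C : GSC} (G : FaceGraph C) where
  open FaceGraph G
  open Walks asGraph using (module CycleOrder)

  private
    Incident : Fin nG → Fin (GSC.nF C) → Bool
    Incident v f = does (end₁ f ≟ v) ∨ does (end₂ f ≟ v)

    incident⁻ : ∀ {v f} → T (Incident v f) → v ≡ end₁ f ⊎ v ≡ end₂ f
    incident⁻ {v} {f} t = Data.Sum.map (sym ∘ fromDoes (end₁ f ≟ v)) (sym ∘ fromDoes (end₂ f ≟ v))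
                                       (to (T-∨ {does (end₁ f ≟ v)}) t)

    incident⁺ : ∀ {v f} → v ≡ end₁ f ⊎ v ≡ end₂ f → T (Incident v f)
    incident⁺ {v} {f} v∈f = from (T-∨ {does (end₁ f ≟ v)})
      (Data.Sum.map (toDoes (end₁ f ≟ v) ∘ sym) (toDoes (end₂ f ≟ v) ∘ sym) v∈f)

  degree : (Fin (GSC.nF C) → Bool) → Fin nG → ℕ
  degree p v = count (GSC.nF C) (λ f → p f ∧ Incident v f)

  cycle-degree : (p : Fin (GSC.nF C) → Bool) (c : Cycle asGraph) →
                 (∀ {f} → T (p f) → cycleEdges asGraph c f) → (∀ i → T (p (Cycle.es c i))) →
                 ∀ {a b : Fin (suc (Cycle.len c))} → a ≢ b → ∀ v → degree p v ≡ 2 ⊎ degree p v ≡ 0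
  cycle-degree p c p⊆c c⊆p a≢b v with any? (λ j → CycleOrder.vtx c j ≟ v)
  ... | yes (j , vⱼ≡v) = inj₁ (count-two _ _ (es j) (es (prev j)) (λ e → prev-fixpoint-free a≢b j (sym (es-inj e)))
                                 (counted j (inj₁ (sym vⱼ≡v)))
                                 (counted (prev j) (inj₂ (trans (sym vⱼ≡v) (cong vtx (sym (next-prev j))))))
                                 only-j)
    where
      open Cycle c
      open CycleOrder c
      counted : ∀ i → v ≡ vtx i ⊎ v ≡ vtx (next i) → T (p (es i) ∧ Incident v (es i))
      counted i v∈eᵢ = from T-∧ (c⊆p i , incident⁺ (SameEnds-∈ (SameEnds-sym (joins-next i)) v∈eᵢ))
      only-j : ∀ f → T (p f ∧ Incident v f) → f ≡ es j ⊎ f ≡ es (prev j)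
      only-j f t with to T-∧ t
      ... | f∈p , v∈f with p⊆c f∈p
      ...   | i , refl with SameEnds-∈ (joins-next i) (incident⁻ v∈f)
      ...     | inj₁ v≡vᵢ = inj₁ (cong es (vs-inj (trans (sym v≡vᵢ) (sym vⱼ≡v))))
      ...     | inj₂ v≡vᵢ₊₁ = inj₂ (cong es (trans (sym (prev-next i)) (cong prev (vs-inj (trans (sym v≡vᵢ₊₁) (sym vⱼ≡v))))))
  ... | no v∉c = inj₂ (count-none _ _ λ f t → not-on-c f (to T-∧ t))
    where
      open Cycle c
      open CycleOrder c
      not-on-c : ∀ f → ¬ (T (p f) × T (Incident v f))
      not-on-c f (f∈p , v∈f) with p⊆c f∈p
      ... | i , refl with SameEnds-∈ (joins-next i) (incident⁻ v∈f)
      ...   | inj₁ v≡vᵢ = v∉c (i , sym v≡vᵢ)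
      ...   | inj₂ v≡vᵢ₊₁ = v∉c (next i , sym v≡vᵢ₊₁)

module FaceGeometry (C : GSC) where
  open GSC C

  atE⁻ : ∀ {v a} → T (atE C v a) → v ≡ tail a ⊎ v ≡ head a
  atE⁻ {v} {a} t = Data.Sum.map (sym ∘ fromDoes (tail a ≟ v)) (sym ∘ fromDoes (head a ≟ v))
                                (to (T-∨ {does (tail a ≟ v)}) t)

  atE⁺ : ∀ {v a} → v ≡ tail a ⊎ v ≡ head a → T (atE C v a)
  atE⁺ {v} {a} v∈a = from (T-∨ {does (tail a ≟ v)})
    (Data.Sum.map (toDoes (tail a ≟ v) ∘ sym) (toDoes (head a ≟ v) ∘ sym) v∈a)

  inF⁻ : ∀ {a f} → T (inF C a f) → ∃ λ i → fe f i ≡ a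
  inF⁻ {a} {f} t with anyFin3-elim (λ i → does (fe f i ≟ a)) t
  ... | i , t′ = i , fromDoes (fe f i ≟ a) t′

  fe-inF : ∀ f i → T (inF C (fe f i) f)
  fe-inF f i = anyFin3-intro (λ j → does (fe f j ≟ fe f i)) i (toDoes (fe f i ≟ fe f i) refl)

  atF⁺ : ∀ {v f} m → fv f m ≡ v → T (atF C v f)
  atF⁺ {v} {f} m e = anyFin3-intro (λ j → does (fv f j ≟ v)) m (toDoes (fv f m ≟ v) e)

  fe-atE⁻ : ∀ {v} f i → T (atE C v (fe f i)) → ∃ λ m → fv f m ≡ v × m ≢ i
  fe-atE⁻ f i t with SameEnds-∈ (fe-ends f i) (atE⁻ t)
  ... | inj₁ e = nx i , sym e , nx≢ i
  ... | inj₂ e = nx (nx i) , sym e , nx²≢ i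

  fe-atE⁺ : ∀ {v} f i m → fv f m ≡ v → m ≢ i → T (atE C v (fe f i))
  fe-atE⁺ f i m refl m≢i = atE⁺ (SameEnds-∈ (SameEnds-sym (fe-ends f i))
    (Data.Sum.map (cong (fv f)) (cong (fv f)) (≢⇒nx⊎nx² m≢i)))

  fe-injective : ∀ f {i j} → fe f i ≡ fe f j → i ≡ j
  fe-injective f {i} {j} e = opposite-pair-injective i j (SameEnds-injective (fv-inj f)
    (SameEnds-trans (SameEnds-sym (fe-ends f i)) (subst (λ a → SameEnds (tail a) (head a) _ _) (sym e) (fe-ends f j))))

  -- a vertex of a triangle lies on exactly two of its sides
  at-most-two-sides : ∀ {v F a b c} → T (inF C a F) → T (atE C v a) → T (inF C b F) → T (atE C v b) →
                      T (inF C c F) → T (atE C v c) → a ≢ b → c ≡ a ⊎ c ≡ b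
  at-most-two-sides {v} {F} ia va ib vb ic vc a≢b with inF⁻ ia | inF⁻ ib | inF⁻ ic
  ... | i , refl | j , refl | k , refl with fe-atE⁻ F i va | fe-atE⁻ F j vb | fe-atE⁻ F k vc
  ... | m , eₘ , m≢i | m′ , eₘ′ , m′≢j | m″ , eₘ″ , m″≢k =
    Data.Sum.map (cong (fe F)) (cong (fe F))
      (fin3-pigeonhole (m≢i ∘ sym) (λ j≡m → m′≢j (sym (trans j≡m (same eₘ′))))
                       (λ k≡m → m″≢k (sym (trans k≡m (same eₘ″)))) (a≢b ∘ cong (fe F)))
    where
      same : ∀ {m₁} → fv F m₁ ≡ v → m ≡ m₁
      same e₁ = fv-inj F (trans eₘ (sym e₁))

module LinkGraph (C : GSC) (x : Fin (GSC.nV C)) where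
  open GSC C
  open FaceGeometry C
  open Graph (Link C x) using (Joins)

  LinkV-≡ : {a b : LinkV C x} → proj₁ a ≡ proj₁ b → a ≡ b
  LinkV-≡ {a , p} {.a , q} refl = cong (a ,_) (T-irrelevant p q)

  LinkE-≡ : {a b : LinkE C x} → proj₁ a ≡ proj₁ b → a ≡ b
  LinkE-≡ {a , p} {.a , q} refl = cong (a ,_) (T-irrelevant p q)

  _≟L_ : DecidableEquality (LinkV C x)
  a ≟L b = map′ LinkV-≡ (cong proj₁) (proj₁ a ≟ proj₁ b)

  joins-loopless : Loopless (Link C x)
  joins-loopless h (a≢b , _) = a≢b ∘ cong proj₁

  joins-sym : JoinsSymmetric (Link C x)
  joins-sym h (a≢b , a∈h , b∈h) = a≢b ∘ sym , b∈h , a∈h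

  joins-ends-unique : EndsUnique (Link C x)
  joins-ends-unique h {a} {b} {c} {d} (a≢b , a∈h , b∈h) (c≢d , c∈h , d∈h)
    with at-most-two-sides a∈h (proj₂ a) b∈h (proj₂ b) c∈h (proj₂ c) a≢b
       | at-most-two-sides a∈h (proj₂ a) b∈h (proj₂ b) d∈h (proj₂ d) a≢b
  ... | inj₁ c≡a | inj₁ d≡a = ⊥-elim (c≢d (trans c≡a (sym d≡a)))
  ... | inj₁ c≡a | inj₂ d≡b = inj₁ (LinkV-≡ (sym c≡a) , LinkV-≡ (sym d≡b))
  ... | inj₂ c≡b | inj₁ d≡a = inj₂ (LinkV-≡ (sym d≡a) , LinkV-≡ (sym c≡b))
  ... | inj₂ c≡b | inj₂ d≡b = ⊥-elim (c≢d (trans c≡b (sym d≡b)))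

  inF⇒atF : ∀ {e f} → T (atE C x e) → T (inF C e f) → T (atF C x f)
  inF⇒atF {f = f} x∈e e∈f with inF⁻ e∈f
  ... | i , refl with fe-atE⁻ f i x∈e
  ...   | m , eₘ , _ = atF⁺ m eₘ

  inF⇒joins : ∀ {e} (x∈e : T (atE C x e)) (g : LinkE C x) → T (inF C e (proj₁ g)) →
              ∃ λ w → Joins g (e , x∈e) w
  inF⇒joins x∈e (f , x∈f) e∈f with inF⁻ e∈f
  ... | i , refl with fe-atE⁻ f i x∈e
  ...   | m , eₘ , m≢i with third-index (m≢i ∘ sym)
  ...     | k , k≢i , k≢m = (fe f k , fe-atE⁺ f k m eₘ (k≢m ∘ sym)) ,
                            (k≢i ∘ sym ∘ fe-injective f) , fe-inF f i , fe-inF f k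

module FacesAtEdge (k : Field) (C : GSC) (locally-2-connected : LocallyTwoConnected C) (k-local : KLocal C k)
  (G : FaceGraph C) (same-matroid : SameMatroid (CycleIndep (FaceGraph.asGraph G)) (KIndep k C))
  (e : Fin (GSC.nE C)) where

  open GSC C
  open FaceGeometry C

  Faces : Pred (Fin nF) 0ℓ
  Faces f = T (inF C e f)

  private
    x : Fin nV
    x = tail e

    x∈e : T (atE C x e)
    x∈e = atE⁺ (inj₁ refl)

    open LinkGraph C x
    open VertexStar (Link C x) _≟L_ joins-ends-unique joins-loopless joins-sym (e , x∈e)

    Gr : Graph
    Gr = FaceGraph.asGraph G

    FacesL : Pred (LinkE C x) 0ℓ
    FacesL g = Faces (proj₁ g)

    AtU⇒Faces : ∀ g → AtU g → FacesL g
    AtU⇒Faces g (_ , _ , e∈g , _) = e∈g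

    Faces⇒AtU : ∀ g → Faces (proj₁ g) → AtU g
    Faces⇒AtU = inF⇒joins x∈e

    link-edge : ∀ {f} → Faces f → LinkE C x
    link-edge {f} e∈f = f , inF⇒atF x∈e e∈f

    coindependent⇒independent : ∀ {X} → DualIndep (CycleIndep (Link C x)) X → CycleIndep Gr (faceImage C x X)
    coindependent⇒independent X-coind = proj₂ (same-matroid _) (proj₁ (k-local x _) X-coind)

    independent⇒coindependent : ∀ {X} → CycleIndep Gr (faceImage C x X) → DualIndep (CycleIndep (Link C x)) X
    independent⇒coindependent X-ind = proj₂ (k-local x _) (proj₁ (same-matroid _) X-ind)

  some-face : ∃ Faces
  some-face with covered e
  ... | f , i , refl = f , fe-inF f i

  Faces-dependent : ¬ CycleIndep Gr Faces
  Faces-dependent Faces-ind = no-basis-avoids-star (link-edge f∈) f∈star coind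
    where
      f∈ = proj₂ some-face
      f∈star : AtU (link-edge f∈)
      f∈star = Faces⇒AtU (link-edge f∈) f∈
      coind₀ : DualIndep (CycleIndep (Link C x)) FacesL
      coind₀ = independent⇒coindependent {FacesL} (CycleIndep-antitone proj₂ Faces-ind)
      coind : DualIndep (CycleIndep (Link C x)) AtU
      coind = DualIndep-antitone (λ {g} → AtU⇒Faces g) coind₀

  Faces-minus-one-independent : ∀ {f} → Faces f → DoubleNegation (CycleIndep Gr (λ h → Faces h × h ≢ f))
  Faces-minus-one-independent {f} e∈f = ¬¬-map to-Gr
    (star-minus-edge-coindependent (locally-2-connected x) proj₁ LinkE-≡ (not ∘ inF C e)
      (λ g t g∈star → T-not⇒¬T t (AtU⇒Faces g g∈star)) (λ g ¬at → ¬T⇒T-not (¬at ∘ Faces⇒AtU g))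
      (link-edge e∈f) (Faces⇒AtU (link-edge e∈f) e∈f))
    where
      to-Gr : DualIndep (CycleIndep (Link C x)) (λ g → AtU g × g ≢ link-edge e∈f) → CycleIndep Gr (λ h → Faces h × h ≢ f)
      to-Gr coind = CycleIndep-antitone (λ (e∈h , h≢f) → inF⇒atF x∈e e∈h , e∈h , h≢f)
        (coindependent⇒independent {λ g → FacesL g × proj₁ g ≢ f} (DualIndep-antitone (λ {g} (e∈g , g≢f) → Faces⇒AtU g e∈g , g≢f ∘ cong proj₁) coind))

  two-faces : ∃ λ f₁ → ∃ λ f₂ → Faces f₁ × Faces f₂ × f₁ ≢ f₂
  two-faces with some-face
  ... | f , e∈f with another-star-edge (locally-2-connected x) (link-edge e∈f) (Faces⇒AtU (link-edge e∈f) e∈f)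
  ...   | g , g∈star , g≢f = f , proj₁ g , e∈f , AtU⇒Faces g g∈star , λ f≡g → g≢f (LinkE-≡ (sym f≡g))

lemma4p1 : (k : Field) (C : GSC) → LocallyTwoConnected C → KLocal C k →
    (G : FaceGraph C) →
    SameMatroid (CycleIndep (FaceGraph.asGraph G)) (KIndep k C) →
    ∀ v e → (FaceGraph.sparseCount G v e ≡ 2) ⊎ (FaceGraph.sparseCount G v e ≡ 0)
lemma4p1 k C l2c kl G sm v e =
  decidable-stable (FaceGraph.sparseCount G v e ≟ℕ 2 ⊎-dec FaceGraph.sparseCount G v e ≟ℕ 0) do
    (c , c⊆Faces) ← dependent⇒cycle Faces-dependent
    let Faces⊆c = circuit⊆cycle Gr _≟_ c c⊆Faces Faces-minus-one-independent
        f₁ , f₂ , f₁∈ , f₂∈ , f₁≢f₂ = two-faces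
        i₁ , eᵢ₁≡f₁ = Faces⊆c f₁∈
        i₂ , eᵢ₂≡f₂ = Faces⊆c f₂∈
    pure (cycle-degree G (inF C e) c Faces⊆c (λ i → c⊆Faces (i , refl))
                       (λ i₁≡i₂ → f₁≢f₂ (trans (sym eᵢ₁≡f₁) (trans (cong (Cycle.es c) i₁≡i₂) eᵢ₂≡f₂))) v)
  where
    open FacesAtEdge k C l2c kl G sm e
    Gr = FaceGraph.asGraph G
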